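{- Let $L$ be a finite modular semilattice, let $B\subseteq L^n$ be $(\wedge,\vee)$-closed, and let $i\in[n]$ and $l\in L$ be such that the base $\mathbf{e}^i_l=\min\{\mathbf{b}\in B\mid \mathbf{b}[i]=l\}$ exists. Then for every $\mathbf{b}\in B$: $\mathbf{e}^i_l\le\mathbf{b}$ if and only if $l\le\mathbf{b}[i]$.
   Context: Semilattices are meet-semilattices; joins may not exist. A semilattice is modular if both of the following hold: every principal ideal is a modular lattice; and $x\vee y\vee z$ exists whenever $x\vee y$, $y\vee z$, $z\vee x$ exist. $L^n$ has the componentwise order, and $\mathbf{b}[i]$ denotes the $i$-th component of $\mathbf{b}$. $B\subseteq L^n$ is $(\wedge,\vee)$-closed if both of the following hold: - $B$ is closed under $\wedge$; - $b_1\vee b_2\in B$ whenever $b_1,b_2\in B$ and $b_1\vee b_2$ exists in $L^n$. -}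

module Defs where

open import Level using (Level; _⊔_)
open import Data.Nat using (ℕ)
open import Data.Fin using (Fin)
open import Data.Product using (Σ; _×_; _,_; ∃)
open import Relation.Unary using (Pred; _∈_)
open import Relation.Binary using (Rel)
open import Relation.Binary.Lattice.Bundles using (MeetSemilattice)

IsJoin : ∀ {a ℓ} {A : Set a} → Rel A ℓ → A → A → A → Set (a ⊔ ℓ)
IsJoin _≤_ x y j = (x ≤ j) × (y ≤ j) × (∀ u → x ≤ u → y ≤ u → j ≤ u)

IsJoin3 : ∀ {a ℓ} {A : Set a} → Rel A ℓ → A → A → A → A → Set (a ⊔ ℓ)
IsJoin3 _≤_ x y z j =
  (x ≤ j) × (y ≤ j) × (z ≤ j) × (∀ u → x ≤ u → y ≤ u → z ≤ u → j ≤ u)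

module _ {c ℓ₁ ℓ₂ : Level} (L : MeetSemilattice c ℓ₁ ℓ₂) where
  open MeetSemilattice L

  IsFinite : Set (c ⊔ ℓ₁)
  IsFinite = Σ ℕ λ k → Σ (Fin k → Carrier) λ f → ∀ x → ∃ λ i → f i ≈ x

  IsJoinIn : Carrier → Carrier → Carrier → Carrier → Set (c ⊔ ℓ₂)
  IsJoinIn a x y j =
    (j ≤ a) × (x ≤ j) × (y ≤ j) × (∀ u → u ≤ a → x ≤ u → y ≤ u → j ≤ u)

  -- every principal ideal ↓a is a modular lattice
  -- (meets in ↓a are those of L; joins are taken inside ↓a)
  PrincipalIdealsModularLattices : Set (c ⊔ ℓ₁ ⊔ ℓ₂)
  PrincipalIdealsModularLattices =
    (∀ a x y → x ≤ a → y ≤ a → ∃ λ j → IsJoinIn a x y j)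
    × (∀ a x y z → x ≤ a → y ≤ a → z ≤ a → x ≤ z →
         ∀ j₁ j₂ → IsJoinIn a x (y ∧ z) j₁ → IsJoinIn a x y j₂ →
         j₁ ≈ (j₂ ∧ z))

  TripleJoinCondition : Set (c ⊔ ℓ₂)
  TripleJoinCondition =
    ∀ x y z → ∃ (IsJoin _≤_ x y) → ∃ (IsJoin _≤_ y z) → ∃ (IsJoin _≤_ z x) →
      ∃ (IsJoin3 _≤_ x y z)

  IsModular : Set (c ⊔ ℓ₁ ⊔ ℓ₂)
  IsModular = PrincipalIdealsModularLattices × TripleJoinCondition

  _≤ⁿ_ : ∀ {n} → Rel (Fin n → Carrier) ℓ₂
  b₁ ≤ⁿ b₂ = ∀ i → b₁ i ≤ b₂ i

  _∧ⁿ_ : ∀ {n} → (Fin n → Carrier) → (Fin n → Carrier) → (Fin n → Carrier)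
  (b₁ ∧ⁿ b₂) i = b₁ i ∧ b₂ i

  IsMeetJoinClosed : ∀ {n ℓ} → Pred (Fin n → Carrier) ℓ → Set (c ⊔ ℓ₂ ⊔ ℓ)
  IsMeetJoinClosed B =
    (∀ b₁ b₂ → b₁ ∈ B → b₂ ∈ B → (b₁ ∧ⁿ b₂) ∈ B)
    × (∀ b₁ b₂ j → b₁ ∈ B → b₂ ∈ B → IsJoin _≤ⁿ_ b₁ b₂ j → j ∈ B)

  IsBase : ∀ {n ℓ} → Pred (Fin n → Carrier) ℓ → Fin n → Carrier →
           (Fin n → Carrier) → Set (c ⊔ ℓ₁ ⊔ ℓ₂ ⊔ ℓ)
  IsBase B i l e = (e ∈ B) × (e i ≈ l) × (∀ b → b ∈ B → b i ≈ l → e ≤ⁿ b)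

module Submission where

-- Proof idea.
--
-- (⇒) If e ≤ b then l ≈ e[i] ≤ b[i].
-- (⇐) If l ≤ b[i], the meet e ∧ b lies in B and its i-th component is
--     e[i] ∧ b[i] ≈ l ∧ b[i] ≈ l.  Minimality of e among the elements of B
--     with i-th component l gives e ≤ e ∧ b ≤ b.

open import Defs
open import Level using (Level)
open import Data.Nat using (ℕ)
open import Data.Fin using (Fin)
open import Data.Product using (_,_; proj₁)
open import Relation.Unary using (Pred; _∈_)
open import Function.Bundles using (_⇔_; mk⇔)
open import Relation.Binary.Lattice.Bundles using (MeetSemilattice)

module _ {c ℓ₁ ℓ₂ : Level} (L : MeetSemilattice c ℓ₁ ℓ₂) where
  open MeetSemilattice L

  meet-with-upper-bound : ∀ {x y l} → x ≈ l → l ≤ y → (x ∧ y) ≈ l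
  meet-with-upper-bound {x} {y} x≈l l≤y =
    antisym (trans (x∧y≤x x y) (reflexive x≈l))
            (∧-greatest (reflexive (Eq.sym x≈l)) l≤y)

  base-below-iff : ∀ {n ℓ} (B : Pred (Fin n → Carrier) ℓ) →
    (∀ b₁ b₂ → b₁ ∈ B → b₂ ∈ B → (_∧ⁿ_ L b₁ b₂) ∈ B) →
    ∀ i l e → IsBase L B i l e →
    ∀ b → b ∈ B → (_≤ⁿ_ L e b ⇔ l ≤ b i)
  base-below-iff B meet-closed i l e (e∈B , ei≈l , e-min) b b∈B =
    mk⇔ base-below⇒ base-below⇐
    where
    base-below⇒ : _≤ⁿ_ L e b → l ≤ b i
    base-below⇒ e≤b = trans (reflexive (Eq.sym ei≈l)) (e≤b i)

    base-below⇐ : l ≤ b i → _≤ⁿ_ L e b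
    base-below⇐ l≤bi j = trans (e≤e∧b j) (x∧y≤y (e j) (b j))
      where
      e≤e∧b : _≤ⁿ_ L e (_∧ⁿ_ L e b)
      e≤e∧b = e-min (_∧ⁿ_ L e b) (meet-closed e b e∈B b∈B)
                    (meet-with-upper-bound ei≈l l≤bi)

lemma3p5 : ∀ {c ℓ₁ ℓ₂ ℓ : Level} (L : MeetSemilattice c ℓ₁ ℓ₂) →
    IsFinite L → IsModular L →
    (n : ℕ) (B : Pred (Fin n → MeetSemilattice.Carrier L) ℓ) →
    IsMeetJoinClosed L B →
    (i : Fin n) (l : MeetSemilattice.Carrier L) (e : Fin n → MeetSemilattice.Carrier L) →
    IsBase L B i l e →
    ∀ b → b ∈ B → (_≤ⁿ_ L e b ⇔ MeetSemilattice._≤_ L l (b i))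
lemma3p5 L _ _ n B closed = base-below-iff L B (proj₁ closed)
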